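{- Let $[a_1,\ldots,a_n]$ be a positive continued fraction (all $a_i\in\mathbb{Z}_{\ge1}$), and write its value as a reduced fraction $p/q$ with $p,q$ positive coprime integers. For a graph $\mathcal{G}$ let $m(\mathcal{G})$ denote its number of perfect matchings. Then (a) $m(\mathcal{G}[a_1,\ldots,a_n])=p$; (b) $m(\mathcal{G}[a_2,\ldots,a_n])=q$; (c) $[a_1,\ldots,a_n]=\dfrac{m(\mathcal{G}[a_1,\ldots,a_n])}{m(\mathcal{G}[a_2,\ldots,a_n])}$ (and this fraction is reduced).
   Context: A tile is a unit square in the plane with sides parallel to the axes, regarded as a graph with 4 vertices and 4 edges. A snake graph is a planar graph consisting of tiles $G_1,\ldots,G_d$ ($d\ge1$) such that for each $i<d$, $G_i$ and $G_{i+1}$ share exactly one edge $e_i$, which is either the north edge of $G_i$ and south edge of $G_{i+1}$, or the east edge of $G_i$ and west edge of $G_{i+1}$; the single-edge graph is also a snake graph (0 tiles). $e_0$ is the south edge of $G_1$; the northeast edges are the north and east edges of $G_d$. A sign function is a map $f$ from edges to $\{+,-\}$ such that on each tile north and west edges have equal sign, south and east edges have equal sign, and north and south have opposite signs. A snake graph together with a choice $e_d$ of one of its northeast edges is determined by its sign sequence $(f(e_0),\ldots,f(e_d))$ up to global sign flip. For positive integers $a_1,\ldots,a_n$ with $d=a_1+\cdots+a_n-1$, $\mathcal{G}[a_1,\ldots,a_n]$ is the snake graph with $d$ tiles whose sign sequence (for suitable $e_d$) consists of $n$ consecutive constant blocks of lengths $a_1,\ldots,a_n$ with alternating signs; $\mathcal{G}[1]$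 is the single edge. A perfect matching is a set of edges such that every vertex lies in exactly one of them. -}

module Defs where

open import Data.Bool using (Bool; true; false; not; if_then_else_)
open import Data.Nat using (ℕ; zero; suc; _+_; _≡ᵇ_)
open import Data.Nat.Properties using () renaming (_≟_ to _≟ℕ_)
open import Data.Product using (_×_; _,_)
open import Data.Product.Properties using (≡-dec)
open import Data.List using (List; []; _∷_; length; filter; deduplicate; concatMap; map; foldr)
open import Data.Vec using (Vec; []; _∷_)
open import Relation.Nullary using (yes; no)
open import Relation.Binary.PropositionalEquality using (_≡_)
open import Data.Integer using (+_)
open import Data.Rational as ℚ using (ℚ; 0ℚ; 1/_; ≢-nonZero)
open import Data.Rational.Properties using () renaming (_≟_ to _≟ℚ_)

-- Lattice points (vertices of the snake graph, which lies in the first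
-- quadrant since tiles are only glued to the north or east).
Point : Set
Point = ℕ × ℕ

_≟P_ : (u v : Point) → Relation.Nullary.Dec (u ≡ v)
_≟P_ = ≡-dec _≟ℕ_ _≟ℕ_

-- An edge is an (unordered, but stored with a fixed orientation) pair of points.
Edge : Set
Edge = Point × Point

_≟E_ : (e f : Edge) → Relation.Nullary.Dec (e ≡ f)
_≟E_ = ≡-dec _≟P_ _≟P_

-- A finite graph: a duplicate-free list of vertices and of edges.
record Graph : Set where
  constructor graph
  field
    vertices : List Point
    edges    : List Edge
open Graph public

eqP : Point → Point → Bool
eqP (a , b) (c , d) = (a ≡ᵇ c) Data.Bool.∧ (b ≡ᵇ d)

incident : Point → Edge → Bool
incident v (u , w) = eqP v u Data.Bool.∨ eqP v w

degreeIn : Point → (es : List Edge) → Vec Bool (length es) → ℕ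
degreeIn v [] [] = 0
degreeIn v (e ∷ es) (b ∷ bs) =
  (if b Data.Bool.∧ incident v e then 1 else 0) + degreeIn v es bs

isPerfectMatching : (G : Graph) → Vec Bool (length (edges G)) → Bool
isPerfectMatching G S = foldr (λ v acc → (degreeIn v (edges G) S ≡ᵇ 1) Data.Bool.∧ acc) true (vertices G)

subsets : (n : ℕ) → List (Vec Bool n)
subsets zero = [] ∷ []
subsets (suc n) = map (true ∷_) (subsets n) Data.List.++ map (false ∷_) (subsets n)

numPerfectMatchings : Graph → ℕ
numPerfectMatchings G =
  length (filter (λ S → Data.Bool._≟_ (isPerfectMatching G S) true) (subsets (length (edges G))))

data Sign : Set where
  plus minus : Sign

flip : Sign → Sign
flip plus = minus
flip minus = plus

sameSign : Sign → Sign → Bool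
sameSign plus plus = true
sameSign minus minus = true
sameSign _ _ = false

-- Tile positions (south-west corners).  Invariant of `go s h p rest`:
-- s is the sign of the edge e_i by which the current tile G_{i+1} is
-- entered, h says whether e_i is horizontal (i.e. a south edge of G_{i+1})
-- or vertical (a west edge), and p is the position of G_{i+1}.
-- The sign rules on a tile give: e_{i+1} has the same orientation as e_i
-- iff f(e_i) ≠ f(e_{i+1}).  If e_{i+1} is horizontal (north edge), the
-- next tile lies to the north; otherwise to the east.
tilesGo : Sign → Bool → Point → List Sign → List Point
tilesGo s h p [] = []
tilesGo s h (x , y) (s' ∷ rest) =
  (x , y) ∷ tilesGo s' h' (if h' then (x , suc y) else (suc x , y)) rest
  where
  h' : Bool
  h' = if sameSign s s' then not h else h

-- From a sign sequence (f(e_0), …, f(e_d)) the tiles G_1,…,G_d;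
-- e_0 is the south edge of G_1, placed at the origin.
tilesOf : List Sign → List Point
tilesOf [] = []
tilesOf (s ∷ rest) = tilesGo s true (0 , 0) rest

tileEdges : Point → List Edge
tileEdges (x , y) =
  ((x , y) , (suc x , y)) ∷ ((x , suc y) , (suc x , suc y)) ∷
  ((x , y) , (x , suc y)) ∷ ((suc x , y) , (suc x , suc y)) ∷ []

tileVertices : Point → List Point
tileVertices (x , y) = (x , y) ∷ (suc x , y) ∷ (x , suc y) ∷ (suc x , suc y) ∷ []

-- The snake graph determined by a sign sequence (f(e_0),…,f(e_d)).
--  * d ≥ 1: union of the tiles (shared vertices/edges identified);
--  * d = 0 (one sign): the single edge e_0;
--  * empty sign sequence: the empty graph (convention).
snakeOfSigns : List Sign → Graph
snakeOfSigns [] = graph [] []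
snakeOfSigns (s ∷ []) = graph ((0 , 0) ∷ (1 , 0) ∷ []) (((0 , 0) , (1 , 0)) ∷ [])
snakeOfSigns ss@(_ ∷ _ ∷ _) =
  graph (deduplicate _≟P_ (concatMap tileVertices (tilesOf ss)))
        (deduplicate _≟E_ (concatMap tileEdges (tilesOf ss)))

replicateS : ℕ → Sign → List Sign
replicateS zero s = []
replicateS (suc n) s = s ∷ replicateS n s

-- n consecutive constant blocks of lengths a₁,…,aₙ with alternating signs
-- (starting with +; the global sign is irrelevant).
blockSigns : Sign → List ℕ → List Sign
blockSigns s [] = []
blockSigns s (a ∷ as) = replicateS a s Data.List.++ blockSigns (flip s) as

snakeCF : List ℕ → Graph
snakeCF as = snakeOfSigns (blockSigns plus as)

-- total inverse (1/0 := 0; never used on 0 for positive continued fractions)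
inv : ℚ → ℚ
inv q with q ≟ℚ 0ℚ
... | yes _ = 0ℚ
... | no q≢0 = (1/ q) {{≢-nonZero q≢0}}

cfValue : ℕ → List ℕ → ℚ
cfValue a [] = ((+ a) ℚ./ 1)
cfValue a (b ∷ bs) = ((+ a) ℚ./ 1) ℚ.+ inv (cfValue b bs)

-- Perfect matchings are counted by deciding the edges one at a time while remembering how often
-- each vertex is already covered.  The first tile of a snake graph has two corners that no other
-- tile touches, so once the edges at those corners are decided the count reduces to the rest G′
-- of the snake:  m(G) = m(G′) + m⁻(G′), where m⁻ counts the matchings of a snake with the
-- endpoints of its first edge removed, and m⁻(G) is m⁻(G′) or m(G′) according to whether the
-- first two signs agree.  Along a sign sequence with blocks a₁, …, aₙ this is the recursion of
-- the continuants, so m(𝒢[a₁,…,aₙ]) = K(a₁,…,aₙ) and m(𝒢[a₂,…,aₙ]) = K(a₂,…,aₙ).  Consecutive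
-- continuants are coprime with quotient [a₁,…,aₙ], and a reduced fraction is unique.
module Submission where

open import Defs
open import Data.Bool using (Bool; true; false; not; if_then_else_; _∧_)
open import Data.Bool.Properties using (T-≡; T-∧)
open import Data.Integer using (+_)
import Data.Integer as ℤ
import Data.Integer.Properties as ℤ
open import Data.List using (List; []; _∷_; _++_; length; filter; map; foldr; concatMap; deduplicate)
open import Data.List.Membership.Propositional using (_∈_; _∉_)
open import Data.List.Membership.Propositional.Properties using (∈-++⁺ˡ; ∈-++⁺ʳ; ∈-++⁻; deduplicate-∈⇔)
open import Data.List.Membership.Propositional.Properties.WithK using (unique∧set⇒bag)
open import Data.List.Properties using (length-++; filter-++; filter-≐)
open import Data.List.Relation.Binary.BagAndSetEquality
  using (_∼[_]_; set; [_]-Equality; ++-cong; bag-=⇒; ↭⇒∼bag; ∼bag⇒↭)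
open import Data.List.Relation.Binary.Disjoint.Propositional using (Disjoint)
open import Data.List.Relation.Binary.Permutation.Propositional as ↭ using (_↭_)
open import Data.List.Relation.Binary.Permutation.Propositional.Properties using (shift; ++⁺ʳ)
open import Data.List.Relation.Binary.Subset.Propositional using (_⊆_)
open import Data.List.Relation.Unary.All using (All; []; _∷_; all?; tabulate; lookup)
open import Data.List.Relation.Unary.AllPairs using ([]; _∷_)
open import Data.List.Relation.Unary.Any using (here; there)
open import Data.List.Relation.Unary.Unique.DecPropositional.Properties _≟E_ using (deduplicate-!)
open import Data.List.Relation.Unary.Unique.Propositional using (Unique)
import Data.List.Relation.Unary.Unique.Propositional.Properties as Unique
open import Data.Nat using (ℕ; zero; suc; _+_; _*_; _≤_; _≡ᵇ_; NonZero; >-nonZero; s≤s; z≤n)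
open import Data.Nat.Coprimality as Coprime using (Coprime; coprime-+; 1-coprimeTo; coprime⇒gcd≡1)
open import Data.Nat.GCD using (gcd)
open import Data.Nat.Properties
  using (_≟_; ≡ᵇ⇒≡; ≡⇒≡ᵇ; +-assoc; +-comm; +-identityʳ; *-identityˡ; ≤-refl; ≤-trans; ≤-reflexive;
         m≤m+n; m≤n+m; n≤1+n; 1+n≰n; 1+n≢n; 0≢1+n; +-commutativeSemigroup)
open import Algebra.Properties.CommutativeSemigroup +-commutativeSemigroup using (interchange)
open import Data.Product using (_×_; _,_; proj₁; proj₂; Σ)
open import Data.Rational as ℚ using (mkℚ; _/_; ↥_; ↧_)
import Data.Rational.Properties as ℚ
open import Data.Sum using ([_,_])
open import Data.Vec using (Vec; []; _∷_)
open import Function using (_∘_; id)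
open import Function.Bundles using (Equivalence; mk⇔)
open import Relation.Binary.Bundles using (Setoid)
open import Relation.Binary.PropositionalEquality hiding ([_])
import Relation.Binary.Reasoning.Setoid as SetoidReasoning
open import Relation.Nullary using (Dec; does; ¬_; contradiction)
open import Relation.Nullary.Decidable using (map′; does-≡; dec-true; dec-false)
open import Relation.Unary using (Decidable)

module SetEq {A : Set} = Setoid ([ set ]-Equality A)

-- Counting perfect matchings edge by edge

incidence : Point → Edge → ℕ
incidence w e = if incident w e then 1 else 0

Coverage : Set
Coverage = Point → ℕ

uncovered : Coverage
uncovered _ = 0

covered : Edge → Coverage
covered e w = incidence w e

_+ₑ_ : Coverage → Edge → Coverage
(c +ₑ e) w = c w + incidence w e

PerfectlyCovered : Coverage → List Point → Set
PerfectlyCovered c V = All (λ w → c w ≡ 1) V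

perfectlyCovered? : ∀ c V → Dec (PerfectlyCovered c V)
perfectlyCovered? c V = all? (λ w → c w ≟ 1) V

-- The number of S ⊆ E such that every vertex of V is covered exactly once by c and S together.
completions : List Point → List Edge → Coverage → ℕ
completions V []      c = if does (perfectlyCovered? c V) then 1 else 0
completions V (e ∷ E) c = completions V E (c +ₑ e) + completions V E c

isCompletion : List Point → (E : List Edge) → Coverage → Vec Bool (length E) → Bool
isCompletion V E c S = foldr (λ v acc → (c v + degreeIn v E S ≡ᵇ 1) ∧ acc) true V

isCompletion-[] : ∀ V c → isCompletion V [] c [] ≡ does (perfectlyCovered? c V)
isCompletion-[] []      c = refl
isCompletion-[] (v ∷ V) c = cong₂ (λ n b → (n ≡ᵇ 1) ∧ b) (+-identityʳ (c v)) (isCompletion-[] V c)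

isCompletion-true∷ : ∀ V e E c S → isCompletion V (e ∷ E) c (true ∷ S) ≡ isCompletion V E (c +ₑ e) S
isCompletion-true∷ []      e E c S = refl
isCompletion-true∷ (v ∷ V) e E c S =
  cong₂ (λ n b → (n ≡ᵇ 1) ∧ b) (sym (+-assoc (c v) _ _)) (isCompletion-true∷ V e E c S)

length-filter-map : ∀ {A B : Set} {P : B → Set} (P? : Decidable P) (f : A → B) xs →
  length (filter P? (map f xs)) ≡ length (filter (P? ∘ f) xs)
length-filter-map P? f []       = refl
length-filter-map P? f (x ∷ xs) with does (P? (f x))
... | true  = cong suc (length-filter-map P? f xs)
... | false = length-filter-map P? f xs

length-filter-isCompletion : ∀ V E c →
  length (filter (λ S → isCompletion V E c S Data.Bool.≟ true) (subsets (length E))) ≡ completions V E c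
length-filter-isCompletion V [] c rewrite isCompletion-[] V c with does (perfectlyCovered? c V)
... | true  = refl
... | false = refl
length-filter-isCompletion V (e ∷ E) c = begin
  length (filter P? (map (true ∷_) SS ++ map (false ∷_) SS))
    ≡⟨ cong length (filter-++ P? (map (true ∷_) SS) _) ⟩
  length (filter P? (map (true ∷_) SS) ++ filter P? (map (false ∷_) SS))
    ≡⟨ length-++ (filter P? (map (true ∷_) SS)) ⟩
  length (filter P? (map (true ∷_) SS)) + length (filter P? (map (false ∷_) SS))
    ≡⟨ cong₂ _+_ (length-filter-map P? (true ∷_) SS) (length-filter-map P? (false ∷_) SS) ⟩
  length (filter (P? ∘ (true ∷_)) SS) + length (filter (P? ∘ (false ∷_)) SS)
    ≡⟨ cong (λ xs → length xs + length (filter (P? ∘ (false ∷_)) SS)) (filter-≐ (P? ∘ (true ∷_)) _ e-chosen SS) ⟩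
  length (filter (λ S → isCompletion V E (c +ₑ e) S Data.Bool.≟ true) SS) + length (filter (P? ∘ (false ∷_)) SS)
    ≡⟨ cong₂ _+_ (length-filter-isCompletion V E (c +ₑ e)) (length-filter-isCompletion V E c) ⟩
  completions V (e ∷ E) c ∎
  where
  open ≡-Reasoning
  SS = subsets (length E)
  P? = λ S → isCompletion V (e ∷ E) c S Data.Bool.≟ true
  e-chosen = (λ {S} → trans (sym (isCompletion-true∷ V e E c S))) , (λ {S} → trans (isCompletion-true∷ V e E c S))

numPerfectMatchings≡completions : ∀ V E → numPerfectMatchings (graph V E) ≡ completions V E uncovered
numPerfectMatchings≡completions V E = length-filter-isCompletion V E uncovered

completions-cong : ∀ {V V′} E {c c′} → V ∼[ set ] V′ → (∀ {w} → w ∈ V → c w ≡ c′ w) →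
  completions V E c ≡ completions V′ E c′
completions-cong {V} {V′} [] {c} {c′} V≈V′ agree = cong (λ b → if b then 1 else 0) (does-≡ (map′
  (λ once → tabulate λ w∈V′ → let w∈V = from V≈V′ w∈V′ in trans (sym (agree w∈V)) (lookup once w∈V))
  (λ once → tabulate λ w∈V → trans (agree w∈V) (lookup once (to V≈V′ w∈V)))
  (perfectlyCovered? c V)) (perfectlyCovered? c′ V′))
  where open Equivalence
completions-cong (e ∷ E) V≈V′ agree =
  cong₂ _+_ (completions-cong E V≈V′ (λ {w} w∈V → cong (_+ incidence w e) (agree w∈V)))
            (completions-cong E V≈V′ agree)

completions-swap : ∀ V E c x y → completions V (x ∷ y ∷ E) c ≡ completions V (y ∷ x ∷ E) c
completions-swap V E c x y = begin
  (C ((c +ₑ x) +ₑ y) + C (c +ₑ x)) + (C (c +ₑ y) + C c)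
    ≡⟨ cong (λ n → (n + C (c +ₑ x)) + (C (c +ₑ y) + C c)) (completions-cong E SetEq.refl exchange) ⟩
  (C ((c +ₑ y) +ₑ x) + C (c +ₑ x)) + (C (c +ₑ y) + C c)
    ≡⟨ interchange (C ((c +ₑ y) +ₑ x)) (C (c +ₑ x)) (C (c +ₑ y)) (C c) ⟩
  (C ((c +ₑ y) +ₑ x) + C (c +ₑ y)) + (C (c +ₑ x) + C c) ∎
  where
  open ≡-Reasoning
  C = completions V E
  exchange : ∀ {w} → w ∈ V → (c w + incidence w x) + incidence w y ≡ (c w + incidence w y) + incidence w x
  exchange {w} _ = begin
    (c w + incidence w x) + incidence w y ≡⟨ +-assoc (c w) _ _ ⟩
    c w + (incidence w x + incidence w y) ≡⟨ cong₂ _+_ (refl {x = c w}) (+-comm (incidence w x) _) ⟩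
    c w + (incidence w y + incidence w x) ≡⟨ +-assoc (c w) _ _ ⟨
    (c w + incidence w y) + incidence w x ∎

completions-↭ : ∀ V {E E′} c → E ↭ E′ → completions V E c ≡ completions V E′ c
completions-↭ V c ↭.refl         = refl
completions-↭ V c (↭.prep e p)   = cong₂ _+_ (completions-↭ V _ p) (completions-↭ V c p)
completions-↭ V {x ∷ y ∷ E} c (↭.swap x y p) = trans (completions-swap V E c x y)
  (cong₂ _+_ (cong₂ _+_ (completions-↭ V _ p) (completions-↭ V _ p))
             (cong₂ _+_ (completions-↭ V _ p) (completions-↭ V c p)))
completions-↭ V c (↭.trans p q) = trans (completions-↭ V c p) (completions-↭ V c q)

completions-overcovered : ∀ {V} E {c v} → v ∈ V → 2 ≤ c v → completions V E c ≡ 0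
completions-overcovered {V} [] {c} v∈V 2≤cv = cong (λ b → if b then 1 else 0)
  (dec-false (perfectlyCovered? c V) λ once → 1+n≰n (subst (2 ≤_) (lookup once v∈V) 2≤cv))
completions-overcovered (e ∷ E) {c} {v} v∈V 2≤cv =
  cong₂ _+_ (completions-overcovered E v∈V (≤-trans 2≤cv (m≤m+n (c v) (incidence v e))))
            (completions-overcovered E v∈V 2≤cv)

completions-uncoverable : ∀ {V} E {c v} → v ∈ V → c v ≡ 0 → All (λ e → incidence v e ≡ 0) E →
  completions V E c ≡ 0
completions-uncoverable {V} [] {c} v∈V cv≡0 [] = cong (λ b → if b then 1 else 0)
  (dec-false (perfectlyCovered? c V) λ once → 0≢1+n (trans (sym cv≡0) (lookup once v∈V)))
completions-uncoverable (e ∷ E) v∈V cv≡0 (ve≡0 ∷ vE≡0) =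
  cong₂ _+_ (completions-uncoverable E v∈V (cong₂ _+_ cv≡0 ve≡0) vE≡0)
            (completions-uncoverable E v∈V cv≡0 vE≡0)

completions-must-take : ∀ {V} e E {c v} → v ∈ V → c v ≡ 0 → All (λ e → incidence v e ≡ 0) E →
  completions V (e ∷ E) c ≡ completions V E (c +ₑ e)
completions-must-take {V} e E {c} v∈V cv≡0 vE≡0 =
  trans (cong₂ _+_ (refl {x = completions V E (c +ₑ e)}) (completions-uncoverable E v∈V cv≡0 vE≡0))
        (+-identityʳ _)

completions-must-skip : ∀ {V} e E {c v} → v ∈ V → c v ≡ 1 → incidence v e ≡ 1 →
  completions V (e ∷ E) c ≡ completions V E c
completions-must-skip {V} e E {c} v∈V cv≡1 ve≡1 =
  cong (_+ completions V E c) (completions-overcovered E v∈V (≤-reflexive (sym (cong₂ _+_ cv≡1 ve≡1))))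

completions-drop : ∀ {V} E {c v} → c v ≡ 1 → All (λ e → incidence v e ≡ 0) E →
  completions (v ∷ V) E c ≡ completions V E c
completions-drop {V} [] {c} {v} cv≡1 [] = cong (λ b → if b then 1 else 0)
  (does-≡ (map′ (λ { (_ ∷ once) → once }) (cv≡1 ∷_) (perfectlyCovered? c (v ∷ V))) (perfectlyCovered? c V))
completions-drop (e ∷ E) cv≡1 (ve≡0 ∷ vE≡0) =
  cong₂ _+_ (completions-drop E (cong₂ _+_ cv≡1 ve≡0) vE≡0) (completions-drop E cv≡1 vE≡0)

-- Peeling off a tile

eqP-sound : ∀ u v → eqP u v ≡ true → u ≡ v
eqP-sound (a , b) (c , d) eq with Equivalence.to T-∧ (Equivalence.from T-≡ eq)
... | a≡c , b≡d = cong₂ _,_ (≡ᵇ⇒≡ a c a≡c) (≡ᵇ⇒≡ b d b≡d)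

eqP-refl : ∀ u → eqP u u ≡ true
eqP-refl (a , b) = Equivalence.to T-≡ (Equivalence.from T-∧ (≡⇒≡ᵇ a a refl , ≡⇒≡ᵇ b b refl))

eqP-≢ : ∀ {u v} → u ≢ v → eqP u v ≡ false
eqP-≢ {u} {v} u≢v with eqP u v in eq
... | true  = contradiction (eqP-sound u v eq) u≢v
... | false = refl

incidence-fst : ∀ u v → incidence u (u , v) ≡ 1
incidence-fst u v rewrite eqP-refl u = refl

incidence-snd : ∀ u v → incidence v (u , v) ≡ 1
incidence-snd u v rewrite eqP-refl v with eqP v u
... | true  = refl
... | false = refl

incidence-other : ∀ {w u v} → w ≢ u → w ≢ v → incidence w (u , v) ≡ 0
incidence-other w≢u w≢v rewrite eqP-≢ w≢u | eqP-≢ w≢v = refl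

incidence-merge : ∀ {w u v u′ v′} → w ≢ u → w ≢ v → u′ ≢ v′ →
  incidence w (u , u′) + incidence w (v , v′) ≡ incidence w (u′ , v′)
incidence-merge {w} {u′ = u′} {v′} w≢u w≢v u′≢v′ rewrite eqP-≢ w≢u | eqP-≢ w≢v
  with eqP w u′ in eq₁ | eqP w v′ in eq₂
... | true  | true  = contradiction (trans (sym (eqP-sound w u′ eq₁)) (eqP-sound w v′ eq₂)) u′≢v′
... | true  | false = refl
... | false | true  = refl
... | false | false = refl

-- A tile whose corners u , v are met by no other edge, glued to the rest (V′ , E′)
-- of the graph along its exit edge (u′ , v′).
module Tile {u v u′ v′ : Point} {V′ : List Point} {E′ : List Edge}
  (u≢v : u ≢ v) (u≢v′ : u ≢ v′) (v≢u′ : v ≢ u′) (u′≢v′ : u′ ≢ v′)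
  (u∉V′ : u ∉ V′) (v∉V′ : v ∉ V′)
  (u∉E′ : All (λ e → incidence u e ≡ 0) E′) (v∉E′ : All (λ e → incidence v e ≡ 0) E′)
  where

  V : List Point
  V = u ∷ v ∷ V′

  base side side′ exit : Edge
  base  = u , v
  side  = u , u′
  side′ = v , v′
  exit  = u′ , v′

  private
    u∈V : u ∈ V
    u∈V = here refl

    v∈V : v ∈ V
    v∈V = there (here refl)

    w≢u : ∀ {w} → w ∈ V′ → w ≢ u
    w≢u w∈V′ refl = u∉V′ w∈V′

    w≢v : ∀ {w} → w ∈ V′ → w ≢ v
    w≢v w∈V′ refl = v∉V′ w∈V′

    drop-corners : ∀ {c} → c u ≡ 1 → c v ≡ 1 → completions V E′ c ≡ completions V′ E′ c
    drop-corners cu≡1 cv≡1 = trans (completions-drop E′ cu≡1 u∉E′) (completions-drop E′ cv≡1 v∉E′)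

    base-taken : completions V (side ∷ side′ ∷ E′) (covered base) ≡ completions V′ E′ uncovered
    base-taken = begin
      completions V (side ∷ side′ ∷ E′) (covered base)
        ≡⟨ completions-must-skip side (side′ ∷ E′) u∈V (incidence-fst u v) (incidence-fst u u′) ⟩
      completions V (side′ ∷ E′) (covered base)
        ≡⟨ completions-must-skip side′ E′ v∈V (incidence-snd u v) (incidence-fst v v′) ⟩
      completions V E′ (covered base)
        ≡⟨ drop-corners (incidence-fst u v) (incidence-snd u v) ⟩
      completions V′ E′ (covered base)
        ≡⟨ completions-cong E′ SetEq.refl (λ w∈V′ → incidence-other (w≢u w∈V′) (w≢v w∈V′)) ⟩
      completions V′ E′ uncovered ∎
      where open ≡-Reasoning

    side-taken : completions V (side′ ∷ E′) (covered side) ≡ completions V′ E′ (covered exit)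
    side-taken = begin
      completions V (side′ ∷ E′) (covered side)
        ≡⟨ completions-must-take side′ E′ v∈V v-side≡0 v∉E′ ⟩
      completions V E′ (covered side +ₑ side′)
        ≡⟨ drop-corners (cong₂ _+_ (incidence-fst u u′) (incidence-other u≢v u≢v′))
                        (cong₂ _+_ v-side≡0 (incidence-fst v v′)) ⟩
      completions V′ E′ (covered side +ₑ side′)
        ≡⟨ completions-cong E′ SetEq.refl (λ w∈V′ → incidence-merge (w≢u w∈V′) (w≢v w∈V′) u′≢v′) ⟩
      completions V′ E′ (covered exit) ∎
      where
      open ≡-Reasoning
      v-side≡0 : incidence v side ≡ 0
      v-side≡0 = incidence-other (u≢v ∘ sym) v≢u′

  tile-uncovered : completions V (base ∷ side ∷ side′ ∷ E′) uncovered
                 ≡ completions V′ E′ uncovered + completions V′ E′ (covered exit)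
  tile-uncovered = cong₂ _+_ base-taken
    (trans (completions-must-take side (side′ ∷ E′) u∈V refl (incidence-other u≢v u≢v′ ∷ u∉E′)) side-taken)

  tile-base-covered : completions V (base ∷ side ∷ side′ ∷ E′) (covered base) ≡ completions V′ E′ uncovered
  tile-base-covered =
    trans (completions-must-skip base (side ∷ side′ ∷ E′) u∈V (incidence-fst u v) (incidence-fst u v)) base-taken

  tile-side-covered : completions V (base ∷ side ∷ side′ ∷ E′) (covered side) ≡ completions V′ E′ (covered exit)
  tile-side-covered = begin
    completions V (base ∷ side ∷ side′ ∷ E′) (covered side)
      ≡⟨ completions-must-skip base (side ∷ side′ ∷ E′) u∈V (incidence-fst u u′) (incidence-fst u v) ⟩
    completions V (side ∷ side′ ∷ E′) (covered side)
      ≡⟨ completions-must-skip side (side′ ∷ E′) u∈V (incidence-fst u u′) (incidence-fst u u′) ⟩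
    completions V (side′ ∷ E′) (covered side)
      ≡⟨ side-taken ⟩
    completions V′ E′ (covered exit) ∎
    where open ≡-Reasoning

single-edge-uncovered : ∀ u v → completions (u ∷ v ∷ []) ((u , v) ∷ []) uncovered ≡ 1
single-edge-uncovered u v = cong (λ b → (if b then 1 else 0) + 0)
  (dec-true (perfectlyCovered? (covered (u , v)) (u ∷ v ∷ [])) (incidence-fst u v ∷ incidence-snd u v ∷ []))

single-edge-covered : ∀ u v → completions (u ∷ v ∷ []) ((u , v) ∷ []) (covered (u , v)) ≡ 1
single-edge-covered u v = cong₂ _+_
  (completions-overcovered {u ∷ v ∷ []} [] {covered (u , v) +ₑ (u , v)} (here refl)
    (≤-reflexive (sym (cong₂ _+_ (incidence-fst u v) (incidence-fst u v)))))
  (cong (λ b → if b then 1 else 0)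
    (dec-true (perfectlyCovered? (covered (u , v)) (u ∷ v ∷ [])) (incidence-fst u v ∷ incidence-snd u v ∷ [])))

-- Snake graphs tile by tile

-- entry h q is the south (h = true) or west edge of the tile at q, far h q its second endpoint,
-- and next h q the tile across the opposite edge.
far : Bool → Point → Point
far true  (x , y) = suc x , y
far false (x , y) = x , suc y

next : Bool → Point → Point
next h (x , y) = if h then (x , suc y) else (suc x , y)

entry : Bool → Point → Edge
entry h q = q , far h q

-- the orientation rule of tilesGo
turn : Sign → Bool → Sign → Bool
turn s h s′ = if sameSign s s′ then not h else h

innerEdges : Bool → Point → List Edge
innerEdges h q = entry h q ∷ (q , next h q) ∷ (far h q , far h (next h q)) ∷ []

-- The snake from the tile at q on, entered through entry h q, whose edge signs are s ∷ ss:
-- each tile contributes the two corners and three edges it does not share with the next tile.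
snakeEdges : Sign → Bool → Point → List Sign → List Edge
snakeEdges s h q []         = entry h q ∷ []
snakeEdges s h q (s′ ∷ ss) = innerEdges (turn s h s′) q ++ snakeEdges s′ (turn s h s′) (next (turn s h s′) q) ss

snakeVertices : Sign → Bool → Point → List Sign → List Point
snakeVertices s h q []         = q ∷ far h q ∷ []
snakeVertices s h q (s′ ∷ ss) = q ∷ far (turn s h s′) q ∷ snakeVertices s′ (turn s h s′) (next (turn s h s′) q) ss

-- matchings⁻ counts the matchings of the snake with the endpoints of its first edge removed.
mutual
  matchings : Sign → List Sign → ℕ
  matchings s []         = 1
  matchings s (s′ ∷ ss) = matchings s′ ss + matchings⁻ s′ ss

  matchings⁻ : Sign → List Sign → ℕ
  matchings⁻ s []         = 1
  matchings⁻ s (s′ ∷ ss) = if sameSign s s′ then matchings⁻ s′ ss else matchings s′ ss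

_≼_ : Point → Point → Set
(a , b) ≼ (c , d) = a ≤ c × b ≤ d

≼-refl : ∀ {p} → p ≼ p
≼-refl = ≤-refl , ≤-refl

≼-trans : ∀ {p q r} → p ≼ q → q ≼ r → p ≼ r
≼-trans (a , b) (c , d) = ≤-trans a c , ≤-trans b d

≼-far : ∀ h q → q ≼ far h q
≼-far true  _ = n≤1+n _ , ≤-refl
≼-far false _ = ≤-refl , n≤1+n _

≼-next : ∀ h q → q ≼ next h q
≼-next true  _ = ≤-refl , n≤1+n _
≼-next false _ = n≤1+n _ , ≤-refl

next-⋠ : ∀ h q → ¬ next h q ≼ q
next-⋠ true  _ = 1+n≰n ∘ proj₂
next-⋠ false _ = 1+n≰n ∘ proj₁

next-⋠-far : ∀ h q → ¬ next h q ≼ far h q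
next-⋠-far true  _ = 1+n≰n ∘ proj₂
next-⋠-far false _ = 1+n≰n ∘ proj₁

≢-fst : ∀ {A B : Set} {a c : A} {b d : B} → a ≢ c → (a , b) ≢ (c , d)
≢-fst a≢c = a≢c ∘ cong proj₁

≢-snd : ∀ {A B : Set} {a c : A} {b d : B} → b ≢ d → (a , b) ≢ (c , d)
≢-snd b≢d = b≢d ∘ cong proj₂

q≢far : ∀ h q → q ≢ far h q
q≢far true  _ = ≢-fst (1+n≢n ∘ sym)
q≢far false _ = ≢-snd (1+n≢n ∘ sym)

q≢far-next : ∀ h q → q ≢ far h (next h q)
q≢far-next true  _ = ≢-fst (1+n≢n ∘ sym)
q≢far-next false _ = ≢-fst (1+n≢n ∘ sym)

far≢next : ∀ h q → far h q ≢ next h q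
far≢next true  _ = ≢-fst 1+n≢n
far≢next false _ = ≢-fst (1+n≢n ∘ sym)

next≢far-next : ∀ h q → next h q ≢ far h (next h q)
next≢far-next true  _ = ≢-fst (1+n≢n ∘ sym)
next≢far-next false _ = ≢-snd (1+n≢n ∘ sym)

snakeVertices-≽ : ∀ s h q ss {w} → w ∈ snakeVertices s h q ss → q ≼ w
snakeVertices-≽ s h q []         (here refl)         = ≼-refl
snakeVertices-≽ s h q []         (there (here refl)) = ≼-far h q
snakeVertices-≽ s h q (s′ ∷ ss) (here refl)         = ≼-refl
snakeVertices-≽ s h q (s′ ∷ ss) (there (here refl)) = ≼-far (turn s h s′) q
snakeVertices-≽ s h q (s′ ∷ ss) (there (there w∈)) =
  ≼-trans (≼-next (turn s h s′) q) (snakeVertices-≽ s′ _ _ ss w∈)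

snakeEdges-≽ : ∀ s h q ss {e} → e ∈ snakeEdges s h q ss → q ≼ proj₁ e × q ≼ proj₂ e
snakeEdges-≽ s h q []         (here refl) = ≼-refl , ≼-far h q
snakeEdges-≽ s h q (s′ ∷ ss) e∈ with turn s h s′
... | h′ with e∈
...   | here refl                 = ≼-refl , ≼-far h′ q
...   | there (here refl)         = ≼-refl , ≼-next h′ q
...   | there (there (here refl)) = ≼-far h′ q , ≼-trans (≼-next h′ q) (≼-far h′ (next h′ q))
...   | there (there (there e∈′)) =
        let (q′≼fst , q′≼snd) = snakeEdges-≽ s′ h′ (next h′ q) ss e∈′
        in ≼-trans (≼-next h′ q) q′≼fst , ≼-trans (≼-next h′ q) q′≼snd

snakeVertices-∌ : ∀ s h q ss {w} → ¬ q ≼ w → w ∉ snakeVertices s h q ss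
snakeVertices-∌ s h q ss q⋠w w∈ = q⋠w (snakeVertices-≽ s h q ss w∈)

snakeEdges-avoid : ∀ s h q ss {w} → ¬ q ≼ w → All (λ e → incidence w e ≡ 0) (snakeEdges s h q ss)
snakeEdges-avoid s h q ss {w} q⋠w = tabulate λ {e} e∈ →
  let (q≼fst , q≼snd) = snakeEdges-≽ s h q ss e∈
  in incidence-other {w} {proj₁ e} {proj₂ e} (λ { refl → q⋠w q≼fst }) (λ { refl → q⋠w q≼snd })

module SnakeTile (h : Bool) (q : Point) (s′ : Sign) (ss : List Sign) = Tile
  {V′ = snakeVertices s′ h (next h q) ss} {E′ = snakeEdges s′ h (next h q) ss}
  (q≢far h q) (q≢far-next h q) (far≢next h q) (next≢far-next h q)
  (snakeVertices-∌ s′ h (next h q) ss (next-⋠ h q)) (snakeVertices-∌ s′ h (next h q) ss (next-⋠-far h q))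
  (snakeEdges-avoid s′ h (next h q) ss (next-⋠ h q)) (snakeEdges-avoid s′ h (next h q) ss (next-⋠-far h q))

far≡next-not : ∀ h q → far h q ≡ next (not h) q
far≡next-not true  _ = refl
far≡next-not false _ = refl

-- Stated for a variable b so that it can be applied with b = sameSign s s′, which turn unfolds to.
tile-entry-covered : ∀ b h q s′ ss →
  let h′   = if b then not h else h
      rest = completions (snakeVertices s′ h′ (next h′ q) ss) (snakeEdges s′ h′ (next h′ q) ss)
  in completions (q ∷ far h′ q ∷ snakeVertices s′ h′ (next h′ q) ss)
                 (innerEdges h′ q ++ snakeEdges s′ h′ (next h′ q) ss) (covered (entry h q))
     ≡ (if b then rest (covered (entry h′ (next h′ q))) else rest uncovered)
tile-entry-covered true  h q s′ ss rewrite far≡next-not h q = SnakeTile.tile-side-covered (not h) q s′ ss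
tile-entry-covered false h q s′ ss = SnakeTile.tile-base-covered h q s′ ss

snake-completions : ∀ s h q ss →
  completions (snakeVertices s h q ss) (snakeEdges s h q ss) uncovered ≡ matchings s ss
  × completions (snakeVertices s h q ss) (snakeEdges s h q ss) (covered (entry h q)) ≡ matchings⁻ s ss
snake-completions s h q []         = single-edge-uncovered q (far h q) , single-edge-covered q (far h q)
snake-completions s h q (s′ ∷ ss) =
  trans tile-uncovered (cong₂ _+_ ih-uncovered ih-covered) ,
  trans (tile-entry-covered (sameSign s s′) h q s′ ss) (cong₂ (if sameSign s s′ then_else_) ih-covered ih-uncovered)
  where
  open SnakeTile (turn s h s′) q s′ ss
  ih = snake-completions s′ (turn s h s′) (next (turn s h s′) q) ss
  ih-uncovered = proj₁ ih
  ih-covered   = proj₂ ih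

tileVertices-↭ : ∀ h q → tileVertices q ↭ q ∷ far h q ∷ next h q ∷ far h (next h q) ∷ []
tileVertices-↭ true  (x , y) = ↭.refl
tileVertices-↭ false (x , y) = ↭.prep _ (↭.swap _ _ ↭.refl)

tileEdges-↭ : ∀ h q → tileEdges q ↭ innerEdges h q ++ entry h (next h q) ∷ []
tileEdges-↭ true  (x , y) = ↭.prep _ (↭.↭-sym (shift _ (_ ∷ _ ∷ []) []))
tileEdges-↭ false (x , y) = shift _ (_ ∷ _ ∷ []) (_ ∷ [])

entry-ends⊆tileVertices : ∀ h q → q ∷ far h q ∷ [] ⊆ tileVertices q
entry-ends⊆tileVertices h     (x , y) (here refl)         = here refl
entry-ends⊆tileVertices true  (x , y) (there (here refl)) = there (here refl)
entry-ends⊆tileVertices false (x , y) (there (here refl)) = there (there (here refl))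

entry⊆tileEdges : ∀ h q → entry h q ∷ [] ⊆ tileEdges q
entry⊆tileEdges true  (x , y) (here refl) = here refl
entry⊆tileEdges false (x , y) (here refl) = there (there (here refl))

++-absorb : ∀ {A : Set} {xs ys : List A} → xs ⊆ ys → xs ++ ys ∼[ set ] ys
++-absorb {xs = xs} xs⊆ys = mk⇔ ([ xs⊆ys , id ] ∘ ∈-++⁻ xs) (∈-++⁺ʳ xs)

↭⇒∼set : ∀ {A : Set} {xs ys : List A} → xs ↭ ys → xs ∼[ set ] ys
↭⇒∼set = bag-=⇒ ∘ ↭⇒∼bag

snakeVertices-∼ : ∀ s h q ss →
  q ∷ far h q ∷ concatMap tileVertices (tilesGo s h q ss) ∼[ set ] snakeVertices s h q ss
snakeVertices-∼ s h q        []         = SetEq.refl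
snakeVertices-∼ s h (x , y) (s′ ∷ ss) = begin
  q ∷ far h q ∷ tileVertices q ++ rest
    ≈⟨ ++-absorb (∈-++⁺ˡ ∘ entry-ends⊆tileVertices h q) ⟩
  tileVertices q ++ rest
    ≈⟨ ↭⇒∼set (++⁺ʳ rest (tileVertices-↭ h′ q)) ⟩
  q ∷ far h′ q ∷ next h′ q ∷ far h′ (next h′ q) ∷ rest
    ≈⟨ ++-cong {xs₁ = q ∷ far h′ q ∷ []} SetEq.refl (snakeVertices-∼ s′ h′ (next h′ q) ss) ⟩
  snakeVertices s h q (s′ ∷ ss) ∎
  where
  open SetoidReasoning ([ set ]-Equality Point)
  q = x , y
  h′ = turn s h s′
  rest = concatMap tileVertices (tilesGo s′ h′ (next h′ q) ss)

snakeEdges-∼ : ∀ s h q ss →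
  entry h q ∷ concatMap tileEdges (tilesGo s h q ss) ∼[ set ] snakeEdges s h q ss
snakeEdges-∼ s h q        []         = SetEq.refl
snakeEdges-∼ s h (x , y) (s′ ∷ ss) = begin
  entry h q ∷ tileEdges q ++ rest
    ≈⟨ ++-absorb (∈-++⁺ˡ ∘ entry⊆tileEdges h q) ⟩
  tileEdges q ++ rest
    ≈⟨ ↭⇒∼set (++⁺ʳ rest (tileEdges-↭ h′ q)) ⟩
  innerEdges h′ q ++ entry h′ (next h′ q) ∷ rest
    ≈⟨ ++-cong {xs₁ = innerEdges h′ q} SetEq.refl (snakeEdges-∼ s′ h′ (next h′ q) ss) ⟩
  snakeEdges s h q (s′ ∷ ss) ∎
  where
  open SetoidReasoning ([ set ]-Equality Edge)
  q = x , y
  h′ = turn s h s′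
  rest = concatMap tileEdges (tilesGo s′ h′ (next h′ q) ss)

snakeEdges-unique : ∀ s h q ss → Unique (snakeEdges s h q ss)
snakeEdges-unique s h q []         = [] ∷ []
snakeEdges-unique s h q (s′ ∷ ss) =
  Unique.++⁺ inner-unique (snakeEdges-unique s′ h′ (next h′ q) ss) inner-disjoint
  where
  h′ = turn s h s′

  inner-unique : Unique (innerEdges h′ q)
  inner-unique = (≢-snd (far≢next h′ q) ∷ ≢-fst (q≢far h′ q) ∷ []) ∷ (≢-fst (q≢far h′ q) ∷ []) ∷ [] ∷ []

  inner-disjoint : Disjoint (innerEdges h′ q) (snakeEdges s′ h′ (next h′ q) ss)
  inner-disjoint (here refl                 , e∈) = next-⋠ h′ q (proj₁ (snakeEdges-≽ s′ h′ (next h′ q) ss e∈))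
  inner-disjoint (there (here refl)         , e∈) = next-⋠ h′ q (proj₁ (snakeEdges-≽ s′ h′ (next h′ q) ss e∈))
  inner-disjoint (there (there (here refl)) , e∈) = next-⋠-far h′ q (proj₁ (snakeEdges-≽ s′ h′ (next h′ q) ss e∈))

numPerfectMatchings-snakeOfSigns : ∀ s ss → numPerfectMatchings (snakeOfSigns (s ∷ ss)) ≡ matchings s ss
numPerfectMatchings-snakeOfSigns s [] =
  trans (numPerfectMatchings≡completions (snakeVertices s true (0 , 0) []) (snakeEdges s true (0 , 0) []))
        (proj₁ (snake-completions s true (0 , 0) []))
numPerfectMatchings-snakeOfSigns s (s′ ∷ ss) = begin
  numPerfectMatchings (snakeOfSigns (s ∷ s′ ∷ ss))
    ≡⟨ numPerfectMatchings≡completions (deduplicate _≟P_ allVertices) (deduplicate _≟E_ allEdges) ⟩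
  completions (deduplicate _≟P_ allVertices) (deduplicate _≟E_ allEdges) uncovered
    ≡⟨ completions-cong (deduplicate _≟E_ allEdges) vertices-∼ (λ _ → refl) ⟩
  completions (snakeVertices s true (0 , 0) (s′ ∷ ss)) (deduplicate _≟E_ allEdges) uncovered
    ≡⟨ completions-↭ _ uncovered edges-↭ ⟩
  completions (snakeVertices s true (0 , 0) (s′ ∷ ss)) (snakeEdges s true (0 , 0) (s′ ∷ ss)) uncovered
    ≡⟨ proj₁ (snake-completions s true (0 , 0) (s′ ∷ ss)) ⟩
  matchings s (s′ ∷ ss) ∎
  where
  open ≡-Reasoning
  allVertices = concatMap tileVertices (tilesOf (s ∷ s′ ∷ ss))
  allEdges    = concatMap tileEdges (tilesOf (s ∷ s′ ∷ ss))

  vertices-∼ : deduplicate _≟P_ allVertices ∼[ set ] snakeVertices s true (0 , 0) (s′ ∷ ss)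
  vertices-∼ = SetEq.trans (SetEq.sym (deduplicate-∈⇔ _≟P_ {allVertices}))
    (SetEq.trans (SetEq.sym (++-absorb (∈-++⁺ˡ ∘ entry-ends⊆tileVertices true (0 , 0))))
                 (snakeVertices-∼ s true (0 , 0) (s′ ∷ ss)))

  edges-∼ : deduplicate _≟E_ allEdges ∼[ set ] snakeEdges s true (0 , 0) (s′ ∷ ss)
  edges-∼ = SetEq.trans (SetEq.sym (deduplicate-∈⇔ _≟E_ {allEdges}))
    (SetEq.trans (SetEq.sym (++-absorb (∈-++⁺ˡ ∘ entry⊆tileEdges true (0 , 0))))
                 (snakeEdges-∼ s true (0 , 0) (s′ ∷ ss)))

  edges-↭ : deduplicate _≟E_ allEdges ↭ snakeEdges s true (0 , 0) (s′ ∷ ss)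
  edges-↭ = ∼bag⇒↭ (unique∧set⇒bag (deduplicate-! allEdges) (snakeEdges-unique s true (0 , 0) (s′ ∷ ss)) edges-∼)

-- Continuants and continued fractions

continuant : List ℕ → ℕ
continuant []           = 1
continuant (a ∷ [])     = a
continuant (a ∷ b ∷ as) = a * continuant (b ∷ as) + continuant as

continuant-suc : ∀ a as → continuant (suc a ∷ as) ≡ continuant (a ∷ as) + continuant as
continuant-suc a []       = +-comm 1 a
continuant-suc a (b ∷ as) = begin
  continuant (b ∷ as) + a * continuant (b ∷ as) + continuant as   ≡⟨ +-assoc (continuant (b ∷ as)) _ _ ⟩
  continuant (b ∷ as) + (a * continuant (b ∷ as) + continuant as) ≡⟨ +-comm (continuant (b ∷ as)) _ ⟩
  a * continuant (b ∷ as) + continuant as + continuant (b ∷ as)   ∎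
  where open ≡-Reasoning

continuant-positive : ∀ as → All (1 ≤_) as → 1 ≤ continuant as
continuant-positive []           []             = s≤s z≤n
continuant-positive (a ∷ [])     (a≥1 ∷ [])     = a≥1
continuant-positive (a ∷ b ∷ as) (_ ∷ _ ∷ as≥1) = ≤-trans (continuant-positive as as≥1) (m≤n+m _ _)

coprime-*+ : ∀ k {m n} → Coprime m n → Coprime (k * n + m) n
coprime-*+ zero            m⊥n = m⊥n
coprime-*+ (suc k) {m} {n} m⊥n =
  subst (λ x → Coprime x n) (sym (+-assoc n (k * n) m)) (coprime-+ (coprime-*+ k m⊥n))

continuant-coprime : ∀ a as → Coprime (continuant (a ∷ as)) (continuant as)
continuant-coprime a []       = Coprime.sym (1-coprimeTo a)
continuant-coprime a (b ∷ as) = coprime-*+ a (Coprime.sym (continuant-coprime b as))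

sameSign-refl : ∀ s → sameSign s s ≡ true
sameSign-refl plus  = refl
sameSign-refl minus = refl

sameSign-flip : ∀ s → sameSign s (flip s) ≡ false
sameSign-flip plus  = refl
sameSign-flip minus = refl

matchings-blockSigns : ∀ s k as → All (1 ≤_) as →
  matchings s (replicateS k s ++ blockSigns (flip s) as) ≡ continuant (suc k ∷ as)
  × matchings⁻ s (replicateS k s ++ blockSigns (flip s) as) ≡ continuant as
matchings-blockSigns s zero    []           []         = refl , refl
matchings-blockSigns s zero    (suc a ∷ as) (_ ∷ as≥1) rewrite sameSign-flip s =
  cong₂ _+_ (trans (proj₁ ih) (sym (*-identityˡ _))) (proj₂ ih) , proj₁ ih
  where ih = matchings-blockSigns (flip s) a as as≥1
matchings-blockSigns s (suc k) as           as≥1       rewrite sameSign-refl s =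
  trans (cong₂ _+_ (proj₁ ih) (proj₂ ih)) (sym (continuant-suc (suc k) as)) , proj₂ ih
  where ih = matchings-blockSigns s k as as≥1

snakeCF-matchings : ∀ as → All (1 ≤_) as → numPerfectMatchings (snakeCF as) ≡ continuant as
snakeCF-matchings []           []         = refl
snakeCF-matchings (suc a ∷ as) (_ ∷ as≥1) =
  trans (numPerfectMatchings-snakeOfSigns plus (replicateS a plus ++ blockSigns minus as))
        (proj₁ (matchings-blockSigns plus a as as≥1))

a+inv[m/n]≡[a*m+n]/m : ∀ a {m n} (m≥1 : 1 ≤ m) (n≥1 : 1 ≤ n) → Coprime m n →
  (+ a) / 1 ℚ.+ inv (_/_ (+ m) n {{>-nonZero n≥1}}) ≡ _/_ (+ (a * m + n)) m {{>-nonZero m≥1}}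
a+inv[m/n]≡[a*m+n]/m a {suc m} {suc n} (s≤s z≤n) (s≤s z≤n) m⊥n = begin
  (+ a) / 1 ℚ.+ inv ((+ suc m) / suc n)
    ≡⟨ cong₂ (λ x y → x ℚ.+ inv y) (ℚ.normalize-coprime (Coprime.sym (1-coprimeTo a))) (ℚ.normalize-coprime m⊥n) ⟩
  mkℚ (+ a) 0 (Coprime.sym (1-coprimeTo a)) ℚ.+ mkℚ (+ suc n) m (Coprime.sym m⊥n)
    ≡⟨ ℚ./-cong numerator (*-identityˡ (suc m)) ⟩
  (+ (a * suc m + suc n)) / suc m ∎
  where
  open ≡-Reasoning
  numerator : + a ℤ.* + suc m ℤ.+ + suc n ℤ.* + 1 ≡ + (a * suc m + suc n)
  numerator = begin
    + a ℤ.* + suc m ℤ.+ + suc n ℤ.* + 1 ≡⟨ cong₂ ℤ._+_ (sym (ℤ.pos-* a (suc m))) (ℤ.*-identityʳ (+ suc n)) ⟩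
    + (a * suc m) ℤ.+ + suc n           ≡⟨ ℤ.pos-+ (a * suc m) (suc n) ⟨
    + (a * suc m + suc n)               ∎

cfValue-continuant : ∀ a as (as≥1 : All (1 ≤_) as) →
  cfValue a as ≡ _/_ (+ continuant (a ∷ as)) (continuant as) {{>-nonZero (continuant-positive as as≥1)}}
cfValue-continuant a []       []                = refl
cfValue-continuant a (b ∷ as) as≥1@(_ ∷ bs≥1) =
  trans (cong (λ x → (+ a) / 1 ℚ.+ inv x) (cfValue-continuant b as bs≥1))
        (a+inv[m/n]≡[a*m+n]/m a (continuant-positive (b ∷ as) as≥1) (continuant-positive as bs≥1)
                                (continuant-coprime b as))

↥-/-coprime : ∀ m n .{{_ : NonZero n}} → Coprime m n → ↥ ((+ m) / n) ≡ + m
↥-/-coprime m n m⊥n = begin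
  ↥ ((+ m) / n)               ≡⟨ ℤ.*-identityʳ _ ⟨
  ↥ ((+ m) / n) ℤ.* + 1       ≡⟨ cong (λ g → ↥ ((+ m) / n) ℤ.* + g) (coprime⇒gcd≡1 m⊥n) ⟨
  ↥ ((+ m) / n) ℤ.* + gcd m n ≡⟨ ℚ.↥-/ (+ m) n ⟩
  + m                         ∎
  where open ≡-Reasoning

↧-/-coprime : ∀ m n .{{_ : NonZero n}} → Coprime m n → ↧ ((+ m) / n) ≡ + n
↧-/-coprime m n m⊥n = begin
  ↧ ((+ m) / n)               ≡⟨ ℤ.*-identityʳ _ ⟨
  ↧ ((+ m) / n) ℤ.* + 1       ≡⟨ cong (λ g → ↧ ((+ m) / n) ℤ.* + g) (coprime⇒gcd≡1 m⊥n) ⟨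
  ↧ ((+ m) / n) ℤ.* + gcd m n ≡⟨ ℚ.↧-/ (+ m) n ⟩
  + n                         ∎
  where open ≡-Reasoning

/-injective-coprime : ∀ {m n m′ n′} .{{_ : NonZero n}} .{{_ : NonZero n′}} → Coprime m n → Coprime m′ n′ →
  (+ m) / n ≡ (+ m′) / n′ → m ≡ m′ × n ≡ n′
/-injective-coprime {m} {n} {m′} {n′} m⊥n m′⊥n′ eq =
  ℤ.+-injective (trans (sym (↥-/-coprime m n m⊥n)) (trans (cong ↥_ eq) (↥-/-coprime m′ n′ m′⊥n′))) ,
  ℤ.+-injective (trans (sym (↧-/-coprime m n m⊥n)) (trans (cong ↧_ eq) (↧-/-coprime m′ n′ m′⊥n′)))

theorem3p4 : (a₁ : ℕ) (as : List ℕ) → 1 ≤ a₁ → All (λ a → 1 ≤ a) as →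
    (p q : ℕ) → .{{_ : NonZero q}} → 1 ≤ p → Coprime p q →
    cfValue a₁ as ≡ (+ p) / q →
    (numPerfectMatchings (snakeCF (a₁ ∷ as)) ≡ p)
    × (numPerfectMatchings (snakeCF as) ≡ q)
    × Σ (NonZero (numPerfectMatchings (snakeCF as))) (λ nz →
        (cfValue a₁ as ≡ _/_ (+ numPerfectMatchings (snakeCF (a₁ ∷ as))) (numPerfectMatchings (snakeCF as)) {{nz}})
        × Coprime (numPerfectMatchings (snakeCF (a₁ ∷ as))) (numPerfectMatchings (snakeCF as)))
theorem3p4 a₁ as a₁≥1 as≥1 p q _ p⊥q value≡p/q
  rewrite snakeCF-matchings (a₁ ∷ as) (a₁≥1 ∷ as≥1) | snakeCF-matchings as as≥1 =
  proj₁ reduced , proj₂ reduced , nonZero , value≡K/K , continuant-coprime a₁ as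
  where
  nonZero   = >-nonZero (continuant-positive as as≥1)
  value≡K/K = cfValue-continuant a₁ as as≥1
  reduced   = /-injective-coprime {{nonZero}} (continuant-coprime a₁ as) p⊥q (trans (sym value≡K/K) value≡p/q)
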